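{- For each $n\geq 2$ let $t_n$ be any integer in $\{2,\ldots,n\}$ minimizing $F_n(x)=x^{2}+r(a+1)^{2}+(x-1-r)a^{2}$ over feasible $x\in\{2,\ldots,n\}$, where $n-x=a(x-1)+r$ with $a\in\mathbb{N}_0$, $0\leq r<x-1$, and $x$ is feasible if $x\geq a$ when $r=0$ and $x\geq a+1$ when $r\neq0$. Then $t_n=\Theta(n^{2/3})$, i.e., there are constants $0<c\leq C$ and $N$ such that $c\,n^{2/3}\leq t_n\leq C\,n^{2/3}$ for all $n\geq N$.
   Context: $\mathbb{N}_0$ is the set of nonnegative integers. -}

module Defs where

open import Data.Nat using (ℕ; zero; suc; _+_; _*_; _∸_; _^_; _≤_; _<_)
open import Data.Nat.DivMod using (_/_; _%_)
open import Data.Integer using (+_)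
open import Data.Rational using (ℚ) renaming (_/_ to _/ℚ_)
open import Data.Product using (_×_)
open import Relation.Binary.PropositionalEquality using (_≡_; _≢_)

-- For 2 ≤ x ≤ n write  n - x = a (x - 1) + r  with 0 ≤ r < x - 1.
-- Note x ∸ 1 = suc (x ∸ 2) whenever x ≥ 2 (only that case is ever used).
quotA : ℕ → ℕ → ℕ
quotA n x = (n ∸ x) / suc (x ∸ 2)

remR : ℕ → ℕ → ℕ
remR n x = (n ∸ x) % suc (x ∸ 2)

F : ℕ → ℕ → ℕ
F n x = x ^ 2 + remR n x * (quotA n x + 1) ^ 2 + (x ∸ 1 ∸ remR n x) * quotA n x ^ 2

Feasible : ℕ → ℕ → Set
Feasible n x = (remR n x ≡ 0 → quotA n x ≤ x) × (remR n x ≢ 0 → quotA n x + 1 ≤ x)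

IsMinimizer : ℕ → ℕ → Set
IsMinimizer n t =
  2 ≤ t × t ≤ n × Feasible n t ×
  ((x : ℕ) → 2 ≤ x → x ≤ n → Feasible n x → F n t ≤ F n x)

ℕ→ℚ : ℕ → ℚ
ℕ→ℚ k = + k /ℚ 1

{-# OPTIONS --safe #-}
module Submission where

-- Write n - x = a (x - 1) + r. Besides x², F n x is the sum of squares of n - x split into
-- x - 1 parts as equal as possible, so by Cauchy–Schwarz it lies between (n - x)² / (x - 1)
-- and (a + 1)(n - x). Let k be the integer cube root of n². The feasible candidate x = k + 1
-- has F ≤ 20 k², so a minimiser t has t² ≤ 20 k², i.e. t ≤ 5 k, giving t³ ≤ 125 n². Then
-- n - t ≥ n / 2, and (n - t)² / (t - 1) ≤ 20 k² gives n² ≤ 80 k² t, hence k ≤ 80 t and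
-- n² ≤ 80³ t³.

open import Defs

module MinimizerBounds where
  open import Data.Nat
  open import Data.Nat.DivMod using (m≡m%n+[m/n]*n; m%n<n; m/n*n≤m)
  open import Data.Nat.Properties
  open import Data.Nat.Tactic.RingSolver using (solve-∀)
  open import Data.Product using (_×_; _,_; ∃-syntax)
  open import Relation.Binary.PropositionalEquality using (_≡_; refl; sym; cong; cong₂; subst; subst₂)
  open import Relation.Nullary using (yes; no)
  open ≤-Reasoning

  ≤-offset : ∀ {m n} o → m + o ≡ n → m ≤ n
  ≤-offset o refl = m≤m+n _ o

  square-cancel-≤ : ∀ {m n} → m * m ≤ n * n → m ≤ n
  square-cancel-≤ m²≤n² = ≮⇒≥ λ n<m → <⇒≱ (*-mono-< n<m n<m) m²≤n²

  cube-mono-≤ : ∀ {m n} → m ≤ n → m * m * m ≤ n * n * n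
  cube-mono-≤ m≤n = *-mono-≤ (*-mono-≤ m≤n m≤n) m≤n

  [c*m]³≡c³*m³ : ∀ c m → c * m * (c * m) * (c * m) ≡ c * c * c * (m * m * m)
  [c*m]³≡c³*m³ = solve-∀

  1+m≤2*m : ∀ {m} → 1 ≤ m → suc m ≤ 2 * m
  1+m≤2*m {suc i} _ = ≤-offset i (identity i)
    where
    identity : ∀ j → 2 + j + j ≡ 2 * (1 + j)
    identity = solve-∀

  m≤[m∸n]+[m∸n] : ∀ {m n} → n + n ≤ m → m ≤ (m ∸ n) + (m ∸ n)
  m≤[m∸n]+[m∸n] {m} {n} n+n≤m = ≤-trans (m≤n+m∸n m n) (+-monoˡ-≤ (m ∸ n) (m+n≤o⇒m≤o∸n n n+n≤m))

  cubeRoot : ∀ m → ∃[ k ] k * k * k ≤ m × m < suc k * suc k * suc k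
  cubeRoot zero = 0 , z≤n , s≤s z≤n
  cubeRoot (suc m) with cubeRoot m
  ... | k , k³≤m , m<[1+k]³ with suc m <? suc k * suc k * suc k
  ...   | yes 1+m<[1+k]³ = k , m≤n⇒m≤1+n k³≤m , 1+m<[1+k]³
  ...   | no 1+m≮[1+k]³ = suc k , ≮⇒≥ 1+m≮[1+k]³ , ≤-<-trans m<[1+k]³ cube<
    where
    1+k<2+k : suc k < suc (suc k)
    1+k<2+k = n<1+n (suc k)
    cube< : suc k * suc k * suc k < suc (suc k) * suc (suc k) * suc (suc k)
    cube< = *-mono-< (*-mono-< 1+k<2+k 1+k<2+k) 1+k<2+k

  [1+m]³≤[[1+m]*m]² : ∀ {m} → 2 ≤ m → suc m * suc m * suc m ≤ suc m * m * (suc m * m)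
  [1+m]³≤[[1+m]*m]² {suc (suc j)} (s≤s (s≤s z≤n)) = ≤-offset ((3 + j) * (3 + j) * (j * j + 3 * j + 1)) (identity j)
    where
    identity : ∀ i → (3 + i) * (3 + i) * (3 + i) + (3 + i) * (3 + i) * (i * i + 3 * i + 1)
                     ≡ (3 + i) * (2 + i) * ((3 + i) * (2 + i))
    identity = solve-∀

  -- Cauchy–Schwarz for a list of r entries equal to a + 1 and s entries equal to a.
  sum²≤sumOfSquares*length : ∀ r s a →
    (r * (a + 1) + s * a) * (r * (a + 1) + s * a) ≤ (r * ((a + 1) * (a + 1)) + s * (a * a)) * (r + s)
  sum²≤sumOfSquares*length r s a = ≤-offset (r * s) (identity r s a)
    where
    identity : ∀ p q b → (p * (b + 1) + q * b) * (p * (b + 1) + q * b) + p * q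
                         ≡ (p * ((b + 1) * (b + 1)) + q * (b * b)) * (p + q)
    identity = solve-∀

  sumOfSquares≤[a+1]*sum : ∀ r s a →
    r * ((a + 1) * (a + 1)) + s * (a * a) ≤ (a + 1) * (r * (a + 1) + s * a)
  sumOfSquares≤[a+1]*sum r s a = ≤-offset (s * a) (identity r s a)
    where
    identity : ∀ p q b → p * ((b + 1) * (b + 1)) + q * (b * b) + q * b ≡ (b + 1) * (p * (b + 1) + q * b)
    identity = solve-∀

  cost : ℕ → ℕ → ℕ
  cost n x = remR n x * ((quotA n x + 1) * (quotA n x + 1)) + (x ∸ 1 ∸ remR n x) * (quotA n x * quotA n x)

  m^2≡m*m : ∀ m → m ^ 2 ≡ m * m
  m^2≡m*m m = cong (m *_) (*-identityʳ m)

  F≡x²+cost : ∀ n x → F n x ≡ x * x + cost n x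
  F≡x²+cost n x = begin-equality
    x ^ 2 + r * (a + 1) ^ 2 + s * a ^ 2   ≡⟨ +-assoc (x ^ 2) _ _ ⟩
    x ^ 2 + (r * (a + 1) ^ 2 + s * a ^ 2) ≡⟨ cong₂ _+_ (m^2≡m*m x) (cong₂ _+_
                                               (cong (r *_) (m^2≡m*m (a + 1))) (cong (s *_) (m^2≡m*m a))) ⟩
    x * x + cost n x                       ∎
    where
    r = remR n x
    s = x ∸ 1 ∸ r
    a = quotA n x

  remR+[x∸1∸remR]≡x∸1 : ∀ n x → 2 ≤ x → remR n x + (x ∸ 1 ∸ remR n x) ≡ x ∸ 1
  remR+[x∸1∸remR]≡x∸1 n (suc (suc y)) (s≤s (s≤s z≤n)) = m+[n∸m]≡n (<⇒≤ (m%n<n (n ∸ suc (suc y)) (suc y)))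

  n∸x≡remR*[quotA+1]+[x∸1∸remR]*quotA : ∀ n x → 2 ≤ x →
    n ∸ x ≡ remR n x * (quotA n x + 1) + (x ∸ 1 ∸ remR n x) * quotA n x
  n∸x≡remR*[quotA+1]+[x∸1∸remR]*quotA n x@(suc (suc y)) 2≤x@(s≤s (s≤s z≤n)) = begin-equality
    n ∸ x            ≡⟨ m≡m%n+[m/n]*n (n ∸ x) (suc y) ⟩
    r + a * suc y    ≡⟨ cong (λ d → r + a * d) (remR+[x∸1∸remR]≡x∸1 n x 2≤x) ⟨
    r + a * (r + s)  ≡⟨ identity r s a ⟩
    r * (a + 1) + s * a ∎
    where
    r = remR n x
    s = x ∸ 1 ∸ r
    a = quotA n x
    identity : ∀ p q b → p + b * (p + q) ≡ p * (b + 1) + q * b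
    identity = solve-∀

  quotA*[x∸1]≤n∸x : ∀ n x → 2 ≤ x → quotA n x * (x ∸ 1) ≤ n ∸ x
  quotA*[x∸1]≤n∸x n (suc (suc y)) (s≤s (s≤s z≤n)) = m/n*n≤m (n ∸ suc (suc y)) (suc y)

  [n∸x]²≤cost*[x∸1] : ∀ n x → 2 ≤ x → (n ∸ x) * (n ∸ x) ≤ cost n x * (x ∸ 1)
  [n∸x]²≤cost*[x∸1] n x 2≤x =
    subst₂ (λ m d → m * m ≤ cost n x * d)
      (sym (n∸x≡remR*[quotA+1]+[x∸1∸remR]*quotA n x 2≤x)) (remR+[x∸1∸remR]≡x∸1 n x 2≤x)
      (sum²≤sumOfSquares*length (remR n x) (x ∸ 1 ∸ remR n x) (quotA n x))

  cost≤[quotA+1]*[n∸x] : ∀ n x → 2 ≤ x → cost n x ≤ (quotA n x + 1) * (n ∸ x)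
  cost≤[quotA+1]*[n∸x] n x 2≤x =
    subst (λ m → cost n x ≤ (quotA n x + 1) * m)
      (sym (n∸x≡remR*[quotA+1]+[x∸1∸remR]*quotA n x 2≤x))
      (sumOfSquares≤[a+1]*sum (remR n x) (x ∸ 1 ∸ remR n x) (quotA n x))

  module _ {n k : ℕ} (2≤k : 2 ≤ k) (k³≤n² : k * k * k ≤ n * n)
           (n²<[1+k]³ : n * n < suc k * suc k * suc k) where
    private
      instance
        k≢0 : NonZero k
        k≢0 = >-nonZero (≤-trans (s≤s z≤n) 2≤k)

      2≤1+k : 2 ≤ suc k
      2≤1+k = m≤n⇒m≤1+n 2≤k

    k<n : k < n
    k<n = ≰⇒> λ n≤k → <⇒≱ (m<m*n (k * k) k {{m*n≢0 k k}} 2≤k) (≤-trans k³≤n² (*-mono-≤ n≤k n≤k))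

    10k≤n : 1000 ≤ n → 10 * k ≤ n
    10k≤n 1000≤n = ≮⇒≥ λ n<10k → <⇒≱ (n<1000 n<10k) 1000≤n
      where
      n<1000 : n < 10 * k → n < 1000
      n<1000 n<10k = *-cancelʳ-< (n * n) n (10 * 10 * 10) (begin-strict
        n * (n * n)                    ≡⟨ *-assoc n n n ⟨
        n * n * n                      <⟨ *-mono-< (*-mono-< n<10k n<10k) n<10k ⟩
        10 * k * (10 * k) * (10 * k)   ≡⟨ [c*m]³≡c³*m³ 10 k ⟩
        10 * 10 * 10 * (k * k * k)     ≤⟨ *-monoʳ-≤ (10 * 10 * 10) k³≤n² ⟩
        10 * 10 * 10 * (n * n)         ∎)

    quotA*k≤n : quotA n (suc k) * k ≤ n
    quotA*k≤n = ≤-trans (quotA*[x∸1]≤n∸x n (suc k) 2≤1+k) (m∸n≤m n (suc k))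

    quotA≤k : quotA n (suc k) ≤ k
    quotA≤k = ≮⇒≥ λ k<a → <-irrefl refl (begin-strict
      suc k * suc k * suc k    ≤⟨ [1+m]³≤[[1+m]*m]² 2≤k ⟩
      suc k * k * (suc k * k)  ≤⟨ *-mono-≤ ([1+k]*k≤n k<a) ([1+k]*k≤n k<a) ⟩
      n * n                    <⟨ n²<[1+k]³ ⟩
      suc k * suc k * suc k    ∎)
      where
      [1+k]*k≤n : k < quotA n (suc k) → suc k * k ≤ n
      [1+k]*k≤n k<a = ≤-trans (*-monoˡ-≤ k k<a) quotA*k≤n

    candidate-feasible : Feasible n (suc k)
    candidate-feasible =
      (λ _ → m≤n⇒m≤1+n quotA≤k) , (λ _ → ≤-trans (+-monoˡ-≤ 1 quotA≤k) (≤-reflexive (+-comm k 1)))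

    F[1+k]≤20k² : F n (suc k) ≤ 20 * (k * k)
    F[1+k]≤20k² = *-cancelˡ-≤ k (begin
      k * F n (suc k)                                          ≡⟨ cong (k *_) (F≡x²+cost n (suc k)) ⟩
      k * (suc k * suc k + cost n (suc k))                     ≡⟨ *-distribˡ-+ k _ _ ⟩
      k * (suc k * suc k) + k * cost n (suc k)                 ≤⟨ +-mono-≤ (*-monoʳ-≤ k (*-mono-≤ 1+k≤2k 1+k≤2k))
                                                                            k*cost≤2[1+k]³ ⟩
      k * (2 * k * (2 * k)) + 2 * (suc k * suc k * suc k)      ≤⟨ +-monoʳ-≤ _ (*-monoʳ-≤ 2 (cube-mono-≤ 1+k≤2k)) ⟩
      k * (2 * k * (2 * k)) + 2 * (2 * k * (2 * k) * (2 * k))  ≡⟨ identity k ⟩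
      k * (20 * (k * k))                                       ∎)
      where
      a = quotA n (suc k)
      1+k≤2k : suc k ≤ 2 * k
      1+k≤2k = 1+m≤2*m (≤-trans (s≤s z≤n) 2≤k)
      k*cost≤2[1+k]³ : k * cost n (suc k) ≤ 2 * (suc k * suc k * suc k)
      k*cost≤2[1+k]³ = begin
        k * cost n (suc k)            ≤⟨ *-monoʳ-≤ k (cost≤[quotA+1]*[n∸x] n (suc k) 2≤1+k) ⟩
        k * ((a + 1) * (n ∸ suc k))   ≡⟨ rearrange k a (n ∸ suc k) ⟩
        (a * k + k) * (n ∸ suc k)     ≤⟨ *-mono-≤ (+-mono-≤ quotA*k≤n (<⇒≤ k<n)) (m∸n≤m n (suc k)) ⟩
        (n + n) * n                   ≡⟨ double n ⟩
        2 * (n * n)                   ≤⟨ *-monoʳ-≤ 2 (<⇒≤ n²<[1+k]³) ⟩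
        2 * (suc k * suc k * suc k)   ∎
        where
        rearrange : ∀ i b m → i * ((b + 1) * m) ≡ (b * i + i) * m
        rearrange = solve-∀
        double : ∀ m → (m + m) * m ≡ 2 * (m * m)
        double = solve-∀
      identity : ∀ i → i * (2 * i * (2 * i)) + 2 * (2 * i * (2 * i) * (2 * i)) ≡ i * (20 * (i * i))
      identity = solve-∀

    module _ {t : ℕ} (2≤t : 2 ≤ t) (t-minimal : ∀ x → 2 ≤ x → x ≤ n → Feasible n x → F n t ≤ F n x) where
      t²+cost≤20k² : t * t + cost n t ≤ 20 * (k * k)
      t²+cost≤20k² = begin
        t * t + cost n t  ≡⟨ F≡x²+cost n t ⟨
        F n t             ≤⟨ t-minimal (suc k) 2≤1+k k<n candidate-feasible ⟩
        F n (suc k)       ≤⟨ F[1+k]≤20k² ⟩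
        20 * (k * k)      ∎

      t≤5k : t ≤ 5 * k
      t≤5k = square-cancel-≤ (begin
        t * t             ≤⟨ m≤m+n (t * t) (cost n t) ⟩
        t * t + cost n t  ≤⟨ t²+cost≤20k² ⟩
        20 * (k * k)      ≤⟨ ≤-offset (5 * (k * k)) (identity k) ⟩
        5 * k * (5 * k)   ∎)
        where
        identity : ∀ i → 20 * (i * i) + 5 * (i * i) ≡ 5 * i * (5 * i)
        identity = solve-∀

      t³≤5³n² : t * t * t ≤ 5 * 5 * 5 * (n * n)
      t³≤5³n² = begin
        t * t * t                  ≤⟨ cube-mono-≤ t≤5k ⟩
        5 * k * (5 * k) * (5 * k)  ≡⟨ [c*m]³≡c³*m³ 5 k ⟩
        5 * 5 * 5 * (k * k * k)    ≤⟨ *-monoʳ-≤ (5 * 5 * 5) k³≤n² ⟩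
        5 * 5 * 5 * (n * n)        ∎

      n²≤80³t³ : 1000 ≤ n → n * n ≤ 80 * 80 * 80 * (t * t * t)
      n²≤80³t³ 1000≤n = begin
        n * n                          ≤⟨ n²≤80k²t ⟩
        80 * (k * k) * t               ≤⟨ *-monoˡ-≤ t (*-monoʳ-≤ 80 (*-mono-≤ k≤80t k≤80t)) ⟩
        80 * (80 * t * (80 * t)) * t   ≡⟨ cube 80 t ⟩
        80 * 80 * 80 * (t * t * t)     ∎
        where
        quadruple : ∀ i → (i + i) * (i + i) ≡ 4 * (i * i)
        quadruple = solve-∀
        swap : ∀ a b c → a * b * c ≡ a * c * b
        swap = solve-∀
        cube : ∀ c i → c * (c * i * (c * i)) * i ≡ c * c * c * (i * i * i)
        cube = solve-∀
        m = n ∸ t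
        t+t≤n : t + t ≤ n
        t+t≤n = ≤-trans (+-mono-≤ t≤5k t≤5k) (≤-trans (≤-reflexive (sym (*-distribʳ-+ k 5 5))) (10k≤n 1000≤n))
        n≤m+m : n ≤ m + m
        n≤m+m = m≤[m∸n]+[m∸n] {n = t} t+t≤n
        n²≤80k²t : n * n ≤ 80 * (k * k) * t
        n²≤80k²t = begin
          n * n                     ≤⟨ *-mono-≤ n≤m+m n≤m+m ⟩
          (m + m) * (m + m)         ≡⟨ quadruple m ⟩
          4 * (m * m)               ≤⟨ *-monoʳ-≤ 4 ([n∸x]²≤cost*[x∸1] n t 2≤t) ⟩
          4 * (cost n t * (t ∸ 1))  ≤⟨ *-monoʳ-≤ 4 (*-mono-≤ (≤-trans (m≤n+m (cost n t) (t * t)) t²+cost≤20k²) (m∸n≤m t 1)) ⟩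
          4 * (20 * (k * k) * t)    ≡⟨ *-assoc 4 (20 * (k * k)) t ⟨
          4 * (20 * (k * k)) * t    ≡⟨ cong (_* t) (*-assoc 4 20 (k * k)) ⟨
          80 * (k * k) * t          ∎
        k≤80t : k ≤ 80 * t
        k≤80t = *-cancelʳ-≤ k (80 * t) (k * k) {{m*n≢0 k k}} (begin
          k * (k * k)       ≡⟨ *-assoc k k k ⟨
          k * k * k         ≤⟨ k³≤n² ⟩
          n * n             ≤⟨ n²≤80k²t ⟩
          80 * (k * k) * t  ≡⟨ swap 80 (k * k) t ⟩
          80 * t * (k * k)  ∎)

  n²<[1+k]³⇒2≤k : ∀ {n k} → 3 ≤ n → n * n < suc k * suc k * suc k → 2 ≤ k
  n²<[1+k]³⇒2≤k 3≤n n²<[1+k]³ =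
    ≮⇒≥ λ k<2 → <⇒≱ (<-≤-trans n²<[1+k]³ (cube-mono-≤ k<2)) (≤-trans (n≤1+n 8) (*-mono-≤ 3≤n 3≤n))

  minimizer-bounds : ∀ {n t} → 1000 ≤ n → IsMinimizer n t →
    n * n ≤ 80 * 80 * 80 * (t * t * t) × t * t * t ≤ 5 * 5 * 5 * (n * n)
  minimizer-bounds {n} 1000≤n (2≤t , _ , _ , t-minimal) =
    let (k , k³≤n² , n²<[1+k]³) = cubeRoot (n * n)
        2≤k = n²<[1+k]³⇒2≤k {k = k} (≤-trans (s≤s (s≤s (s≤s z≤n))) 1000≤n) n²<[1+k]³
    in n²≤80³t³ {k = k} 2≤k k³≤n² n²<[1+k]³ 2≤t t-minimal 1000≤n ,
       t³≤5³n² {k = k} 2≤k k³≤n² n²<[1+k]³ 2≤t t-minimal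

module NaturalEmbedding where
  open import Data.Integer.Base as ℤ using (+_; +≤+)
  import Data.Integer.Properties as ℤ
  import Data.Nat.Base as ℕ
  open import Data.Nat.Coprimality using (1-coprimeTo) renaming (sym to coprime-sym)
  open import Data.Rational.Base using (1ℚ; mkℚ; NonNegative; _*_; _≤_; *≤*)
  open import Data.Rational.Properties using (normalize-coprime; *-monoˡ-≤-nonNeg; *-assoc; *-identityˡ; module ≤-Reasoning)
  open import Relation.Binary.PropositionalEquality using (_≡_; refl; sym; trans; cong; cong₂; subst₂)
  open ≤-Reasoning

  ℕ→ℚ≡mkℚ : ∀ m → ℕ→ℚ m ≡ mkℚ (+ m) 0 (coprime-sym (1-coprimeTo m))
  ℕ→ℚ≡mkℚ m = normalize-coprime (coprime-sym (1-coprimeTo m))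

  ℕ→ℚ-homo-* : ∀ m o → ℕ→ℚ (m ℕ.* o) ≡ ℕ→ℚ m * ℕ→ℚ o
  ℕ→ℚ-homo-* m o rewrite ℕ→ℚ≡mkℚ m | ℕ→ℚ≡mkℚ o | sym (ℤ.pos-* m o) = refl

  ℕ→ℚ-mono-≤ : ∀ {m o} → m ℕ.≤ o → ℕ→ℚ m ≤ ℕ→ℚ o
  ℕ→ℚ-mono-≤ {m} {o} m≤o rewrite ℕ→ℚ≡mkℚ m | ℕ→ℚ≡mkℚ o =
    *≤* (subst₂ ℤ._≤_ (sym (ℤ.*-identityʳ (+ m))) (sym (ℤ.*-identityʳ (+ o))) (+≤+ m≤o))

  ℕ→ℚ-cube : ∀ m → ℕ→ℚ (m ℕ.* m ℕ.* m) ≡ ℕ→ℚ m * ℕ→ℚ m * ℕ→ℚ m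
  ℕ→ℚ-cube m = trans (ℕ→ℚ-homo-* (m ℕ.* m) m) (cong (_* ℕ→ℚ m) (ℕ→ℚ-homo-* m m))

  ℕ→ℚ-≤-inverse* : ∀ q .{{_ : NonNegative q}} K {m o} → q * ℕ→ℚ K ≡ 1ℚ →
    m ℕ.≤ K ℕ.* o → q * ℕ→ℚ m ≤ ℕ→ℚ o
  ℕ→ℚ-≤-inverse* q K {m} {o} q*K≡1 m≤K*o = begin
    q * ℕ→ℚ m               ≤⟨ *-monoˡ-≤-nonNeg q (ℕ→ℚ-mono-≤ m≤K*o) ⟩
    q * ℕ→ℚ (K ℕ.* o)       ≡⟨ cong (q *_) (ℕ→ℚ-homo-* K o) ⟩
    q * (ℕ→ℚ K * ℕ→ℚ o)     ≡⟨ *-assoc q (ℕ→ℚ K) (ℕ→ℚ o) ⟨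
    q * ℕ→ℚ K * ℕ→ℚ o       ≡⟨ cong (_* ℕ→ℚ o) q*K≡1 ⟩
    1ℚ * ℕ→ℚ o              ≡⟨ *-identityˡ (ℕ→ℚ o) ⟩
    ℕ→ℚ o                   ∎

  ℕ→ℚ-square≤scaled-cube : ∀ c .{{_ : NonNegative (c * c * c)}} K {n m} → c * c * c * ℕ→ℚ K ≡ 1ℚ →
    n ℕ.* n ℕ.≤ K ℕ.* (m ℕ.* m ℕ.* m) → c * c * c * (ℕ→ℚ n * ℕ→ℚ n) ≤ ℕ→ℚ m * ℕ→ℚ m * ℕ→ℚ m
  ℕ→ℚ-square≤scaled-cube c K {n} {m} c³*K≡1 n²≤K*m³ =
    subst₂ _≤_ (cong (c * c * c *_) (ℕ→ℚ-homo-* n n)) (ℕ→ℚ-cube m)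
      (ℕ→ℚ-≤-inverse* (c * c * c) K {n ℕ.* n} {m ℕ.* m ℕ.* m} c³*K≡1 n²≤K*m³)

  ℕ→ℚ-cube≤scaled-square : ∀ C {n m} → m ℕ.* m ℕ.* m ℕ.≤ C ℕ.* C ℕ.* C ℕ.* (n ℕ.* n) →
    ℕ→ℚ m * ℕ→ℚ m * ℕ→ℚ m ≤ ℕ→ℚ C * ℕ→ℚ C * ℕ→ℚ C * (ℕ→ℚ n * ℕ→ℚ n)
  ℕ→ℚ-cube≤scaled-square C {n} {m} m³≤C³*n² =
    subst₂ _≤_ (ℕ→ℚ-cube m)
      (trans (ℕ→ℚ-homo-* (C ℕ.* C ℕ.* C) (n ℕ.* n)) (cong₂ _*_ (ℕ→ℚ-cube C) (ℕ→ℚ-homo-* n n)))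
      (ℕ→ℚ-mono-≤ m³≤C³*n²)

open import Data.Nat using (ℕ; _≤_)
open import Data.Rational using (ℚ; 0ℚ; _*_) renaming (_≤_ to _≤ℚ_; _<_ to _<ℚ_)
open import Data.Product using (_×_; ∃-syntax; _,_)
import Data.Nat as ℕ
open import Data.Nat.Properties using (≤-trans)
open import Data.Integer.Base using (+_)
open import Data.Rational using (_/_)
open import Data.Rational.Properties using (_<?_; _≤?_)
open import Relation.Binary.PropositionalEquality using (refl)
open import Relation.Nullary.Decidable using (toWitness)
open MinimizerBounds using (minimizer-bounds)
open NaturalEmbedding using (ℕ→ℚ-square≤scaled-cube; ℕ→ℚ-cube≤scaled-square)

theorem7 : (t : ℕ → ℕ) → ((n : ℕ) → 2 ≤ n → IsMinimizer n (t n)) →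
    ∃[ c ] ∃[ C ] ∃[ N ] (0ℚ <ℚ c × c ≤ℚ C ×
      ((n : ℕ) → N ≤ n →
        (c * c * c * (ℕ→ℚ n * ℕ→ℚ n) ≤ℚ ℕ→ℚ (t n) * ℕ→ℚ (t n) * ℕ→ℚ (t n)) ×
        (ℕ→ℚ (t n) * ℕ→ℚ (t n) * ℕ→ℚ (t n) ≤ℚ C * C * C * (ℕ→ℚ n * ℕ→ℚ n))))
theorem7 t t-minimizes = c , C , 1000 , toWitness {a? = 0ℚ <? c} _ , toWitness {a? = c ≤? C} _ ,
  λ n 1000≤n →
    let (lower , upper) = minimizer-bounds 1000≤n (t-minimizes n (≤-trans (ℕ.s≤s (ℕ.s≤s ℕ.z≤n)) 1000≤n))
    in ℕ→ℚ-square≤scaled-cube c (80 ℕ.* 80 ℕ.* 80) {n} {t n} refl lower ,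
       ℕ→ℚ-cube≤scaled-square 5 {n} {t n} upper
  where
  c C : ℚ
  c = + 1 / 80
  C = ℕ→ℚ 5
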